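{- $$Q_{132}^{(\emptyset,0,\emptyset,0)}(t,x)=\frac{1}{1-tx+t-tC(t)}\quad\text{and}\quad Q_{132}^{(\emptyset,0,\emptyset,0)}(t,0)=\frac{1}{1+t-tC(t)}.$$
   Context: For $\sigma=\sigma_1\cdots\sigma_n\in S_n$, $\mathrm{mmp}^{(\emptyset,0,\emptyset,0)}(\sigma)$ is the number of positions $i$ such that there is no $j>i$ with $\sigma_j>\sigma_i$ and no $j<i$ with $\sigma_j<\sigma_i$ (i.e. $\sigma_i$ is both a right-to-left maximum and a left-to-right minimum). $S_n(132)$ is the set of 132-avoiding permutations of $[n]$. $Q_{n,132}^{(\emptyset,0,\emptyset,0)}(x)=\sum_{\sigma\in S_n(132)}x^{\mathrm{mmp}^{(\emptyset,0,\emptyset,0)}(\sigma)}$ and $Q_{132}^{(\emptyset,0,\emptyset,0)}(t,x)=1+\sum_{n\ge1}t^nQ_{n,132}^{(\emptyset,0,\emptyset,0)}(x)$. $C(t)=\sum_{n\ge0}C_nt^n=\frac{1-\sqrt{1-4t}}{2t}$, $C_n=\frac{1}{n+1}\binom{2n}{n}$. -}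

module Defs where

open import Data.Bool using (Bool; true; false; _∧_; _∨_; if_then_else_)
open import Data.Nat as ℕ using (ℕ; zero; suc; _<ᵇ_; _≡ᵇ_; _∸_; _/_)
open import Data.Nat.Combinatorics using (_C_)
open import Data.Integer as ℤ using (ℤ; +_; -_)
open import Data.List using (List; []; _∷_; _++_; map; concatMap; filter; length)
open import Data.Bool.ListAction using (all; any)
open import Relation.Nullary.Decidable using (⌊_⌋)
open import Data.Bool.Properties using (T?)

-- Permutations of [n] = {1,…,n}, written in one-line notation as lists.

insertions : ℕ → List ℕ → List (List ℕ)
insertions a []       = (a ∷ []) ∷ []
insertions a (b ∷ bs) = (a ∷ b ∷ bs) ∷ map (b ∷_) (insertions a bs)

S : ℕ → List (List ℕ)
S zero    = [] ∷ []
S (suc n) = concatMap (insertions (suc n)) (S n)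

-- Pattern 132: indices i<j<k with σᵢ < σₖ < σⱼ.

has21Above : ℕ → List ℕ → Bool
has21Above a []       = false
has21Above a (b ∷ cs) = any (λ c → (a <ᵇ c) ∧ (c <ᵇ b)) cs ∨ has21Above a cs

contains132 : List ℕ → Bool
contains132 []       = false
contains132 (a ∷ as) = has21Above a as ∨ contains132 as

avoids132 : List ℕ → Bool
avoids132 σ = if contains132 σ then false else true

S132 : ℕ → List (List ℕ)
S132 n = filter (λ σ → T? (avoids132 σ)) (S n)

-- mmp^(∅,0,∅,0)(σ): number of positions i such that no j>i has σⱼ>σᵢ
-- and no j<i has σⱼ<σᵢ.

mmpAux : List ℕ → List ℕ → ℕ
mmpAux pre []        = 0
mmpAux pre (a ∷ suf) =
  (if all (λ b → a <ᵇ b) pre ∧ all (λ c → c <ᵇ a) suf then 1 else 0)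
  ℕ.+ mmpAux (pre ++ (a ∷ [])) suf

mmp : List ℕ → ℕ
mmp σ = mmpAux [] σ

-- Formal power series in t and x with integer coefficients:
-- F n k is the coefficient of tⁿ xᵏ.

FPS : Set
FPS = ℕ → ℕ → ℤ

sumTo : ℕ → (ℕ → ℤ) → ℤ
sumTo zero    f = f 0
sumTo (suc n) f = sumTo n f ℤ.+ f (suc n)

_⊕_ : FPS → FPS → FPS
(F ⊕ G) n k = F n k ℤ.+ G n k

_⊖_ : FPS → FPS → FPS
(F ⊖ G) n k = F n k ℤ.- G n k

_⊛_ : FPS → FPS → FPS
(F ⊛ G) n k = sumTo n (λ i → sumTo k (λ j → F i j ℤ.* G (n ∸ i) (k ∸ j)))

infixl 6 _⊕_ _⊖_
infixl 7 _⊛_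

mono : ℕ → ℕ → FPS
mono a b n k = if (n ≡ᵇ a) ∧ (k ≡ᵇ b) then + 1 else + 0

𝟙 : FPS
𝟙 = mono 0 0

tS : FPS
tS = mono 1 0

xS : FPS
xS = mono 0 1

catalan : ℕ → ℕ
catalan n = ((2 ℕ.* n) C n) / suc n

CS : FPS
CS n zero    = + catalan n
CS n (suc k) = + 0

Qcoeff : ℕ → ℕ → ℕ
Qcoeff n k = length (filter (λ σ → T? (mmp σ ≡ᵇ k)) (S132 n))

Q : FPS
Q zero    zero    = + 1
Q zero    (suc k) = + 0
Q (suc n) k       = + Qcoeff (suc n) k

Q0 : FPS
Q0 n zero    = Q n 0
Q0 n (suc k) = + 0

module Submission where

-- Write σ ∈ S_{n+1} as  A (n+1) B.  Then σ avoids 132 iff every entry of A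
-- exceeds every entry of B and both A and B avoid 132; in that case the points
-- counted by mmp are those of B, plus n+1 itself when A is empty.  Summing over
-- the length i of A gives the recurrence
--     Q_{n+1}(x) = Σ_{i=1}^{n} a_i Q_{n-i}(x) + x Q_n(x),   a_i = #S_i(132),
-- while counting without weights gives a_{n+1} = Σ_{i=0}^{n} a_i a_{n-i}, so a_i = C_i.
-- Multiplying out, this recurrence is the coefficient form of both identities.

open import Defs
open import Data.Nat using (ℕ)
open import Data.Product using (_×_; _,_; proj₁)
open import Data.Bool using (Bool; true; false; _∧_; _∨_; not; if_then_else_; T)
open import Data.Bool.Properties
  using (T?; T-≡; ∧-zeroʳ; ∧-identityʳ; ∧-assoc; ∨-identityʳ; ∨-zeroʳ; ∨-comm; ∨-assoc;
         ∨-commutativeMonoid; ∨-∧-booleanAlgebra)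
open import Algebra.Bundles using (CommutativeMonoid)
open import Algebra.Lattice.Properties.BooleanAlgebra ∨-∧-booleanAlgebra using (deMorgan₂)
open import Algebra.Properties.CommutativeSemigroup
  (CommutativeMonoid.commutativeSemigroup ∨-commutativeMonoid)
  using () renaming (interchange to ∨-interchange)
open import Data.Bool.ListAction using (all; any)
open import Data.List using (List; []; _∷_; _++_; map; concatMap; length; take; drop; filter; null)
open import Data.List.Relation.Unary.All as All using (All; []; _∷_)
open import Data.List.Relation.Unary.AllPairs using (AllPairs; []; _∷_)
open import Function using (_∘_)
open import Function.Bundles using (Equivalence)
open import Relation.Binary.PropositionalEquality
open import Relation.Nullary using (contradiction)

module Counting where
  open import Data.Nat
  open import Data.Nat.Properties
  open import Data.Nat.Tactic.RingSolver using (solve-∀)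
  open import Algebra.Properties.CommutativeSemigroup +-commutativeSemigroup
    using () renaming (interchange to +-interchange)
  open import Data.List.Properties using (++-assoc; ++-identityʳ; take++drop≡id)
  open import Data.List.Relation.Unary.All.Properties using (++⁺; ++⁻ˡ; ++⁻ʳ; drop⁺; concat⁺; map⁺; all⁺)

  ind : Bool → ℕ
  ind b = if b then 1 else 0

  ind-∧ : ∀ x y → ind (x ∧ y) ≡ ind x * ind y
  ind-∧ true  y = sym (+-identityʳ _)
  ind-∧ false y = refl

  ∑ : {A : Set} → List A → (A → ℕ) → ℕ
  ∑ []       f = 0
  ∑ (x ∷ xs) f = f x + ∑ xs f

  sumUpTo : ℕ → (ℕ → ℕ) → ℕ
  sumUpTo zero    f = f 0
  sumUpTo (suc n) f = sumUpTo n f + f (suc n)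

  module _ {A : Set} where

    ∑-++ : (xs ys : List A) (f : A → ℕ) → ∑ (xs ++ ys) f ≡ ∑ xs f + ∑ ys f
    ∑-++ []       ys f = refl
    ∑-++ (x ∷ xs) ys f = trans (cong (f x +_) (∑-++ xs ys f)) (sym (+-assoc (f x) _ _))

    ∑-congᴬ : {L : List A} {f g : A → ℕ} → All (λ x → f x ≡ g x) L → ∑ L f ≡ ∑ L g
    ∑-congᴬ []       = refl
    ∑-congᴬ (e ∷ es) = cong₂ _+_ e (∑-congᴬ es)

    ∑-cong : (L : List A) {f g : A → ℕ} → (∀ x → f x ≡ g x) → ∑ L f ≡ ∑ L g
    ∑-cong L e = ∑-congᴬ {L = L} (All.tabulate (λ {x} _ → e x))

    ∑-+ : (L : List A) (f g : A → ℕ) → ∑ L (λ x → f x + g x) ≡ ∑ L f + ∑ L g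
    ∑-+ []      f g = refl
    ∑-+ (x ∷ L) f g =
      trans (cong (f x + g x +_) (∑-+ L f g)) (+-interchange (f x) (g x) (∑ L f) (∑ L g))

    ∑-*ˡ : (L : List A) (c : ℕ) (f : A → ℕ) → ∑ L (λ x → c * f x) ≡ c * ∑ L f
    ∑-*ˡ []      c f = sym (*-zeroʳ c)
    ∑-*ˡ (x ∷ L) c f = trans (cong (c * f x +_) (∑-*ˡ L c f)) (sym (*-distribˡ-+ c (f x) _))

    ∑-zero : (L : List A) → ∑ L (λ _ → 0) ≡ 0
    ∑-zero []      = refl
    ∑-zero (x ∷ L) = ∑-zero L

    ∑-sumUpTo : (L : List A) (n : ℕ) (f : A → ℕ → ℕ) →
                ∑ L (λ x → sumUpTo n (f x)) ≡ sumUpTo n (λ i → ∑ L (λ x → f x i))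
    ∑-sumUpTo L zero    f = refl
    ∑-sumUpTo L (suc n) f =
      trans (∑-+ L (λ x → sumUpTo n (f x)) (λ x → f x (suc n)))
            (cong (_+ ∑ L (λ x → f x (suc n))) (∑-sumUpTo L n f))

  module _ {A B : Set} where

    ∑-map : (h : A → B) (L : List A) (f : B → ℕ) → ∑ (map h L) f ≡ ∑ L (f ∘ h)
    ∑-map h []      f = refl
    ∑-map h (x ∷ L) f = cong (f (h x) +_) (∑-map h L f)

    ∑-concatMap : (g : A → List B) (L : List A) (f : B → ℕ) →
                  ∑ (concatMap g L) f ≡ ∑ L (λ x → ∑ (g x) f)
    ∑-concatMap g []      f = refl
    ∑-concatMap g (x ∷ L) f =
      trans (∑-++ (g x) (concatMap g L) f) (cong (∑ (g x) f +_) (∑-concatMap g L f))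

  sumUpTo-cong : (n : ℕ) {f g : ℕ → ℕ} → (∀ i → i ≤ n → f i ≡ g i) → sumUpTo n f ≡ sumUpTo n g
  sumUpTo-cong zero    e = e 0 z≤n
  sumUpTo-cong (suc n) e =
    cong₂ _+_ (sumUpTo-cong n (λ i i≤n → e i (m≤n⇒m≤1+n i≤n))) (e (suc n) ≤-refl)

  sumUpTo-front : (n : ℕ) (f : ℕ → ℕ) → sumUpTo (suc n) f ≡ f 0 + sumUpTo n (f ∘ suc)
  sumUpTo-front zero    f = refl
  sumUpTo-front (suc n) f =
    trans (cong (_+ f (suc (suc n))) (sumUpTo-front n f)) (+-assoc (f 0) _ _)

  <ᵇ-true : ∀ {m n} → m < n → (m <ᵇ n) ≡ true
  <ᵇ-true m<n = Equivalence.to T-≡ (<⇒<ᵇ m<n)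

  <ᵇ-true⁻¹ : ∀ {m n} → (m <ᵇ n) ≡ true → m < n
  <ᵇ-true⁻¹ {m} {n} e = <ᵇ⇒< m n (Equivalence.from T-≡ e)

  <ᵇ-false : ∀ {m n} → n ≤ m → (m <ᵇ n) ≡ false
  <ᵇ-false {m} {n} n≤m with m <ᵇ n in e
  ... | false = refl
  ... | true  = contradiction n≤m (<⇒≱ (<ᵇ-true⁻¹ e))

  <ᵇ-false⁻¹ : ∀ {m n} → (m <ᵇ n) ≡ false → n ≤ m
  <ᵇ-false⁻¹ e = ≮⇒≥ (λ m<n → contradiction (trans (sym e) (<ᵇ-true m<n)) λ ())

  module _ {A : Set} where

    any-false : {p : A → Bool} {L : List A} → All (λ x → p x ≡ false) L → any p L ≡ false
    any-false []       = refl
    any-false (e ∷ es) = cong₂ _∨_ e (any-false es)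

    all-true : {p : A → Bool} {L : List A} → All (λ x → p x ≡ true) L → all p L ≡ true
    all-true []       = refl
    all-true (e ∷ es) = cong₂ _∧_ e (all-true es)

    any-cong : {p q : A → Bool} {L : List A} → All (λ x → p x ≡ q x) L → any p L ≡ any q L
    any-cong []       = refl
    any-cong (e ∷ es) = cong₂ _∨_ e (any-cong es)

    any-++ : (p : A → Bool) (X Y : List A) → any p (X ++ Y) ≡ any p X ∨ any p Y
    any-++ p []      Y = refl
    any-++ p (x ∷ X) Y = trans (cong (p x ∨_) (any-++ p X Y)) (sym (∨-assoc (p x) _ _))

    all-++ : (p : A → Bool) (X Y : List A) → all p (X ++ Y) ≡ all p X ∧ all p Y
    all-++ p []      Y = refl
    all-++ p (x ∷ X) Y = trans (cong (p x ∧_) (all-++ p X Y)) (sym (∧-assoc (p x) _ _))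

    any-skip : (p : A → Bool) (m : A) → p m ≡ false → (X Y : List A) →
               any p (X ++ m ∷ Y) ≡ any p (X ++ Y)
    any-skip p m e []      Y = cong (_∨ any p Y) e
    any-skip p m e (x ∷ X) Y = cong (p x ∨_) (any-skip p m e X Y)

    all-false-at : (p : A → Bool) (m : A) → p m ≡ false → (X Y : List A) → all p (X ++ m ∷ Y) ≡ false
    all-false-at p m e []      Y = cong (_∧ all p Y) e
    all-false-at p m e (x ∷ X) Y = trans (cong (p x ∧_) (all-false-at p m e X Y)) (∧-zeroʳ (p x))

  any-map : {A B : Set} (p : B → Bool) (f : A → B) (L : List A) → any p (map f L) ≡ any (p ∘ f) L
  any-map p f []      = refl
  any-map p f (x ∷ L) = cong (p (f x) ∨_) (any-map p f L)

  Dominates : List ℕ → List ℕ → Set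
  Dominates A B = All (λ a → All (_< a) B) A

  dominates : List ℕ → List ℕ → Bool
  dominates A B = all (λ a → all (_<ᵇ a) B) A

  Disjoint : List ℕ → List ℕ → Set
  Disjoint A B = All (λ a → All (_≢ a) B) A

  ascentAcross : List ℕ → List ℕ → Bool
  ascentAcross A B = any (λ a → any (a <ᵇ_) B) A

  dominates-sound : ∀ A B → T (dominates A B) → Dominates A B
  dominates-sound A B t =
    All.map (λ {a} ta → All.map (λ {c} → <ᵇ⇒< c a) (all⁺ _ B ta)) (all⁺ _ A t)

  -- Entries below a can never play the role of the "3" or "2" above a.
  notAbove : ∀ {a} (q : ℕ → Bool) {B} → All (_< a) B → All (λ c → (a <ᵇ c) ∧ q c ≡ false) B
  notAbove q = All.map (λ {c} c<a → cong (_∧ q c) (<ᵇ-false (<⇒≤ c<a)))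

  has21Above-max : ∀ m B → All (_< m) B → has21Above m B ≡ false
  has21Above-max m []       []         = refl
  has21Above-max m (b ∷ cs) (_ ∷ cs<m) =
    cong₂ _∨_ (any-false (notAbove (_<ᵇ b) cs<m)) (has21Above-max m cs cs<m)

  -- Inserting the maximum m creates exactly the new patterns a m c with a < c, c ∈ B.
  has21Above-insertMax : ∀ a m X B → All (_< m) X → All (_< m) B →
    has21Above a (X ++ m ∷ B) ≡ has21Above a (X ++ B) ∨ any (a <ᵇ_) B
  has21Above-insertMax a m [] B _ B<m =
    trans (cong (_∨ has21Above a B) (any-cong (All.map (λ {c} → belowM c) B<m)))
          (∨-comm (any (a <ᵇ_) B) (has21Above a B))
    where
    belowM : ∀ c → c < m → (a <ᵇ c) ∧ (c <ᵇ m) ≡ (a <ᵇ c)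
    belowM c c<m = trans (cong ((a <ᵇ c) ∧_) (<ᵇ-true c<m)) (∧-identityʳ _)
  has21Above-insertMax a m (b ∷ X) B (b<m ∷ X<m) B<m =
    trans (cong₂ _∨_ (any-skip P m Pm X B) (has21Above-insertMax a m X B X<m B<m))
          (sym (∨-assoc (any P (X ++ B)) _ _))
    where
    P : ℕ → Bool
    P c = (a <ᵇ c) ∧ (c <ᵇ b)
    Pm : P m ≡ false
    Pm = trans (cong ((a <ᵇ m) ∧_) (<ᵇ-false (<⇒≤ b<m))) (∧-zeroʳ _)

  contains132-insertMax : ∀ m A B → All (_< m) A → All (_< m) B →
    contains132 (A ++ m ∷ B) ≡ contains132 (A ++ B) ∨ ascentAcross A B
  contains132-insertMax m [] B _ B<m =
    trans (cong (_∨ contains132 B) (has21Above-max m B B<m)) (sym (∨-identityʳ _))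
  contains132-insertMax m (a ∷ A) B (_ ∷ A<m) B<m =
    trans (cong₂ _∨_ (has21Above-insertMax a m A B A<m B<m) (contains132-insertMax m A B A<m B<m))
          (∨-interchange (has21Above a (A ++ B)) _ _ _)

  has21Above-appendLow : ∀ a X B → All (_< a) B → has21Above a (X ++ B) ≡ has21Above a X
  has21Above-appendLow a []      B B<a = has21Above-max a B B<a
  has21Above-appendLow a (b ∷ X) B B<a =
    cong₂ _∨_ (trans (any-++ P X B) (trans (cong (any P X ∨_) (any-false (notAbove (_<ᵇ b) B<a)))
                                           (∨-identityʳ _)))
              (has21Above-appendLow a X B B<a)
    where
    P : ℕ → Bool
    P c = (a <ᵇ c) ∧ (c <ᵇ b)

  contains132-++ : ∀ A B → Dominates A B → contains132 (A ++ B) ≡ contains132 A ∨ contains132 B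
  contains132-++ []      B _          = refl
  contains132-++ (a ∷ A) B (B<a ∷ A≻B) =
    trans (cong₂ _∨_ (has21Above-appendLow a A B B<a) (contains132-++ A B A≻B))
          (sym (∨-assoc (has21Above a A) _ _))

  ascentAcross-dominated : ∀ A B → Dominates A B → ascentAcross A B ≡ false
  ascentAcross-dominated []      B _           = refl
  ascentAcross-dominated (a ∷ A) B (B<a ∷ A≻B) =
    cong₂ _∨_ (any-false (All.map (λ c<a → <ᵇ-false (<⇒≤ c<a)) B<a)) (ascentAcross-dominated A B A≻B)

  someAbove : ∀ a B → all (_<ᵇ a) B ≡ false → All (_≢ a) B → any (a <ᵇ_) B ≡ true
  someAbove a (c ∷ B) e (c≢a ∷ B≢a) with c <ᵇ a in ca
  ... | true  = trans (cong ((a <ᵇ c) ∨_) (someAbove a B e B≢a)) (∨-zeroʳ _)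
  ... | false = cong (_∨ any (a <ᵇ_) B) (<ᵇ-true (≤∧≢⇒< (<ᵇ-false⁻¹ ca) (c≢a ∘ sym)))

  ascentAcross-undominated : ∀ A B → dominates A B ≡ false → Disjoint A B → ascentAcross A B ≡ true
  ascentAcross-undominated (a ∷ A) B e (a∉B ∷ A#B) with all (_<ᵇ a) B in ea
  ... | true  = trans (cong (any (a <ᵇ_) B ∨_) (ascentAcross-undominated A B e A#B)) (∨-zeroʳ _)
  ... | false = cong (_∨ ascentAcross A B) (someAbove a B ea a∉B)

  avoids132-not : ∀ σ → avoids132 σ ≡ not (contains132 σ)
  avoids132-not σ with contains132 σ
  ... | true  = refl
  ... | false = refl

  avoids132-insertMax : ∀ m A B → All (_< m) A → All (_< m) B → Dominates A B →
    avoids132 (A ++ m ∷ B) ≡ avoids132 A ∧ avoids132 B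
  avoids132-insertMax m A B A<m B<m A≻B = begin
    avoids132 (A ++ m ∷ B)                                    ≡⟨ avoids132-not (A ++ m ∷ B) ⟩
    not (contains132 (A ++ m ∷ B))                            ≡⟨ cong not (contains132-insertMax m A B A<m B<m) ⟩
    not (contains132 (A ++ B) ∨ ascentAcross A B)             ≡⟨ cong₂ (λ x y → not (x ∨ y))
                                                                   (contains132-++ A B A≻B)
                                                                   (ascentAcross-dominated A B A≻B) ⟩
    not ((contains132 A ∨ contains132 B) ∨ false)             ≡⟨ cong not (∨-identityʳ _) ⟩
    not (contains132 A ∨ contains132 B)                       ≡⟨ deMorgan₂ (contains132 A) _ ⟩
    not (contains132 A) ∧ not (contains132 B)                 ≡⟨ sym (cong₂ _∧_ (avoids132-not A) (avoids132-not B)) ⟩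
    avoids132 A ∧ avoids132 B                                 ∎
    where open ≡-Reasoning

  -- If A does not dominate B, then some a m c is a 132 pattern.
  avoids132-insertMax-undominated : ∀ m A B → All (_< m) A → All (_< m) B →
    dominates A B ≡ false → Disjoint A B → avoids132 (A ++ m ∷ B) ≡ false
  avoids132-insertMax-undominated m A B A<m B<m e A#B =
    trans (avoids132-not (A ++ m ∷ B))
          (cong not (trans (contains132-insertMax m A B A<m B<m)
                           (trans (cong (contains132 (A ++ B) ∨_) (ascentAcross-undominated A B e A#B))
                                  (∨-zeroʳ _))))

  -- Entries of A are followed by the larger m, so none of them counts in mmp.
  mmpAux-passLow : ∀ m pre A B → All (_< m) A → mmpAux pre (A ++ m ∷ B) ≡ mmpAux (pre ++ A) (m ∷ B)
  mmpAux-passLow m pre []      B _           = cong (λ p → mmpAux p (m ∷ B)) (sym (++-identityʳ pre))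
  mmpAux-passLow m pre (a ∷ A) B (a<m ∷ A<m) =
    cong₂ _+_ (cong ind (trans (cong (all (a <ᵇ_) pre ∧_) aNotMax) (∧-zeroʳ _)))
              (trans (mmpAux-passLow m (pre ++ a ∷ []) A B A<m)
                     (cong (λ p → mmpAux p (m ∷ B)) (++-assoc pre (a ∷ []) A)))
    where
    aNotMax : all (_<ᵇ a) (A ++ m ∷ B) ≡ false
    aNotMax = all-false-at (_<ᵇ a) m (<ᵇ-false (<⇒≤ a<m)) A B

  -- Entries above all of B, standing before B, never block a left-to-right minimum of B.
  mmpAux-dropHigh : ∀ P Q B → All (λ x → All (_< x) B) P → mmpAux (P ++ Q) B ≡ mmpAux Q B
  mmpAux-dropHigh P Q []      _    = refl
  mmpAux-dropHigh P Q (b ∷ B) P≻bB =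
    cong₂ (λ x y → ind (x ∧ all (_<ᵇ b) B) + y)
      (trans (all-++ (b <ᵇ_) P Q)
             (cong (_∧ all (b <ᵇ_) Q) (all-true (All.map (λ b∷B<x → <ᵇ-true (All.head b∷B<x)) P≻bB))))
      (trans (cong (λ p → mmpAux p B) (++-assoc P Q (b ∷ [])))
             (mmpAux-dropHigh P (Q ++ b ∷ []) B (All.map All.tail P≻bB)))

  all-above-null : ∀ m A → All (_< m) A → all (m <ᵇ_) A ≡ null A
  all-above-null m []      _         = refl
  all-above-null m (a ∷ A) (a<m ∷ _) = cong (_∧ all (m <ᵇ_) A) (<ᵇ-false (<⇒≤ a<m))

  mmp-insertMax : ∀ m A B → All (_< m) A → All (_< m) B → Dominates A B →
    mmp (A ++ m ∷ B) ≡ ind (null A) + mmp B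
  mmp-insertMax m A B A<m B<m A≻B = begin
    mmp (A ++ m ∷ B)                                              ≡⟨ mmpAux-passLow m [] A B A<m ⟩
    ind (all (m <ᵇ_) A ∧ all (_<ᵇ m) B) + mmpAux (A ++ m ∷ []) B  ≡⟨ cong₂ (λ x y → ind (x ∧ y) + mmpAux (A ++ m ∷ []) B)
                                                                       (all-above-null m A A<m)
                                                                       (all-true (All.map <ᵇ-true B<m)) ⟩
    ind (null A ∧ true) + mmpAux (A ++ m ∷ []) B                  ≡⟨ cong₂ _+_ (cong ind (∧-identityʳ _)) dropAm ⟩
    ind (null A) + mmp B                                          ∎
    where
    open ≡-Reasoning
    dropAm : mmpAux (A ++ m ∷ []) B ≡ mmp B
    dropAm = trans (cong (λ p → mmpAux p B) (sym (++-identityʳ (A ++ m ∷ []))))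
                   (mmpAux-dropHigh (A ++ m ∷ []) [] B (++⁺ A≻B (B<m ∷ [])))

  -- The weight [σ avoids 132]·H(mmp σ); summing it over S n with H = [· = k]
  -- counts the 132-avoiders with k special points.
  weight : (ℕ → ℕ) → List ℕ → ℕ
  weight H σ = ind (avoids132 σ) * H (mmp σ)

  weight-insertMax : ∀ m A B (H : ℕ → ℕ) → All (_< m) A → All (_< m) B → Disjoint A B →
    weight H (A ++ m ∷ B) ≡
    ind (dominates A B) * (ind (avoids132 A) * weight (λ v → H (ind (null A) + v)) B)
  weight-insertMax m A B H A<m B<m A#B with dominates A B in d
  ... | false = cong (λ x → ind x * H (mmp (A ++ m ∷ B))) (avoids132-insertMax-undominated m A B A<m B<m d A#B)
  ... | true  = begin
    ind (avoids132 (A ++ m ∷ B)) * H (mmp (A ++ m ∷ B))           ≡⟨ cong₂ (λ x y → ind x * H y)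
                                                                       (avoids132-insertMax m A B A<m B<m A≻B)
                                                                       (mmp-insertMax m A B A<m B<m A≻B) ⟩
    ind (avoids132 A ∧ avoids132 B) * H v                         ≡⟨ cong (_* H v) (ind-∧ (avoids132 A) _) ⟩
    ind (avoids132 A) * ind (avoids132 B) * H v                   ≡⟨ *-assoc (ind (avoids132 A)) _ _ ⟩
    ind (avoids132 A) * (ind (avoids132 B) * H v)                 ≡⟨ sym (+-identityʳ _) ⟩
    1 * (ind (avoids132 A) * (ind (avoids132 B) * H v))           ∎
    where
    open ≡-Reasoning
    v : ℕ
    v = ind (null A) + mmp B
    A≻B : Dominates A B
    A≻B = dominates-sound A B (Equivalence.from T-≡ d)

  WellFormed : ℕ → List ℕ → Set
  WellFormed n σ = All (_< suc n) σ × AllPairs _≢_ σ × length σ ≡ n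

  insertions-All : ∀ {P : ℕ → Set} {m} → P m → (τ : List ℕ) → All P τ → All (All P) (insertions m τ)
  insertions-All pm []       []         = (pm ∷ []) ∷ []
  insertions-All pm (b ∷ bs) (pb ∷ pbs) =
    (pm ∷ pb ∷ pbs) ∷ map⁺ (All.map (pb ∷_) (insertions-All pm bs pbs))

  insertions-length : ∀ m τ → All (λ σ → length σ ≡ suc (length τ)) (insertions m τ)
  insertions-length m []       = refl ∷ []
  insertions-length m (b ∷ bs) = refl ∷ map⁺ (All.map (cong suc) (insertions-length m bs))

  insertions-distinct : ∀ m τ → All (_≢ m) τ → AllPairs _≢_ τ → All (AllPairs _≢_) (insertions m τ)
  insertions-distinct m []       _             _                   = ([] ∷ []) ∷ []
  insertions-distinct m (b ∷ bs) (b≢m ∷ bs≢m) (b∉bs ∷ bs-distinct) =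
    (All.map (λ x≢m → x≢m ∘ sym) (b≢m ∷ bs≢m) ∷ b∉bs ∷ bs-distinct)
    ∷ map⁺ (All.zipWith (λ (b∉σ , σ-distinct) → b∉σ ∷ σ-distinct)
                        (insertions-All b≢m bs b∉bs , insertions-distinct m bs bs≢m bs-distinct))

  S-wellFormed : ∀ n → All (WellFormed n) (S n)
  S-wellFormed zero    = ([] , [] , refl) ∷ []
  S-wellFormed (suc n) = concat⁺ (map⁺ (All.map step (S-wellFormed n)))
    where
    step : ∀ {τ} → WellFormed n τ → All (WellFormed (suc n)) (insertions (suc n) τ)
    step {τ} (τ≤n , τ-distinct , len) =
      All.zip ( insertions-All ≤-refl τ (All.map m<n⇒m<1+n τ≤n)
              , All.zip ( insertions-distinct (suc n) τ (All.map (λ x<m x≡m → <-irrefl x≡m x<m) τ≤n) τ-distinct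
                        , All.map (λ e → trans e (cong suc len)) (insertions-length (suc n) τ)))

  ∑-insertions : (m : ℕ) (τ : List ℕ) (h : List ℕ → ℕ) →
    ∑ (insertions m τ) h ≡ sumUpTo (length τ) (λ i → h (take i τ ++ m ∷ drop i τ))
  ∑-insertions m []       h = +-identityʳ _
  ∑-insertions m (b ∷ bs) h =
    trans (cong (h (m ∷ b ∷ bs) +_)
                (trans (∑-map (b ∷_) (insertions m bs) h) (∑-insertions m bs (h ∘ (b ∷_)))))
          (sym (sumUpTo-front (length bs) (λ i → h (take i (b ∷ bs) ++ m ∷ drop i (b ∷ bs)))))

  disjoint-split : ∀ A B → AllPairs _≢_ (A ++ B) → Disjoint A B
  disjoint-split []      B _             = []
  disjoint-split (a ∷ A) B (a∉AB ∷ AB-distinct) =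
    All.map (λ a≢c → a≢c ∘ sym) (++⁻ʳ A a∉AB) ∷ disjoint-split A B AB-distinct

  null-take : ∀ i (τ : List ℕ) → i ≤ length τ → null (take i τ) ≡ (i ≡ᵇ 0)
  null-take zero    τ       _ = refl
  null-take (suc i) (b ∷ τ) _ = refl

  splitsAt : ℕ → List ℕ → Bool
  splitsAt i τ = dominates (take i τ) (drop i τ)

  splitTerm : ℕ → (List ℕ → ℕ) → (List ℕ → ℕ) → List ℕ → ℕ
  splitTerm p F G τ = ind (splitsAt p τ) * (F (take p τ) * G (drop p τ))

  ∑-weight-insertions : ∀ n τ (H : ℕ → ℕ) → WellFormed n τ →
    ∑ (insertions (suc n) τ) (weight H) ≡
    sumUpTo n (λ i → splitTerm i (ind ∘ avoids132) (weight (λ v → H (ind (i ≡ᵇ 0) + v))) τ)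
  ∑-weight-insertions n τ H (τ≤n , τ-distinct , len) =
    trans (∑-insertions (suc n) τ (weight H))
          (trans (cong (λ l → sumUpTo l (λ i → weight H (take i τ ++ suc n ∷ drop i τ))) len)
                 (sumUpTo-cong n atPosition))
    where
    atPosition : ∀ i → i ≤ n → weight H (take i τ ++ suc n ∷ drop i τ) ≡
      splitTerm i (ind ∘ avoids132) (weight (λ v → H (ind (i ≡ᵇ 0) + v))) τ
    atPosition i i≤n =
      trans (weight-insertMax (suc n) (take i τ) (drop i τ) H
                (++⁻ˡ (take i τ) τ≤n′) (++⁻ʳ (take i τ) τ≤n′) (disjoint-split (take i τ) (drop i τ) τ-distinct′))
            (cong (λ b → ind (splitsAt i τ) * (ind (avoids132 (take i τ)) * weight (λ v → H (ind b + v)) (drop i τ)))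
                  (null-take i τ (subst (i ≤_) (sym len) i≤n)))
      where
      τ≤n′ : All (_< suc n) (take i τ ++ drop i τ)
      τ≤n′ = subst (All (_< suc n)) (sym (take++drop≡id i τ)) τ≤n
      τ-distinct′ : AllPairs _≢_ (take i τ ++ drop i τ)
      τ-distinct′ = subst (AllPairs _≢_) (sym (take++drop≡id i τ)) τ-distinct

  splitTerm-congˡ : ∀ p {F F′} G τ → (∀ α → F α ≡ F′ α) → splitTerm p F G τ ≡ splitTerm p F′ G τ
  splitTerm-congˡ p G τ e = cong (λ x → ind (splitsAt p τ) * (x * G (drop p τ))) (e (take p τ))

  splitTerm-+ : ∀ p F F′ G τ →
    splitTerm p F G τ + splitTerm p F′ G τ ≡ splitTerm p (λ α → F α + F′ α) G τ
  splitTerm-+ p F F′ G τ = distribute (ind (splitsAt p τ)) (F (take p τ)) (F′ (take p τ)) (G (drop p τ))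
    where
    distribute : ∀ s f f′ g → s * (f * g) + s * (f′ * g) ≡ s * ((f + f′) * g)
    distribute = solve-∀

  -- Moving the first entry b of the prefix into the weights: b must exceed the suffix.
  splitTerm-cons : ∀ p b F G σ → splitTerm (suc p) F G (b ∷ σ) ≡
    splitTerm p (F ∘ (b ∷_)) (λ δ → ind (all (_<ᵇ b) δ) * G δ) σ
  splitTerm-cons p b F G σ =
    trans (cong (_* (F (b ∷ take p σ) * G (drop p σ))) (ind-∧ (all (_<ᵇ b) (drop p σ)) (splitsAt p σ)))
          (regroup (ind (all (_<ᵇ b) (drop p σ))) (ind (splitsAt p σ)) (F (b ∷ take p σ)) (G (drop p σ)))
    where
    regroup : ∀ x y f g → (x * y) * (f * g) ≡ y * (f * (x * g))
    regroup = solve-∀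

  -- Every insertion of m contains m, so a test failing at m fails on all of them.
  insertions-all-false : ∀ (p : ℕ → Bool) m → p m ≡ false → ∀ τ → All (λ σ → all p σ ≡ false) (insertions m τ)
  insertions-all-false p m e []       = cong (_∧ true) e ∷ []
  insertions-all-false p m e (c ∷ cs) =
    cong (_∧ all p (c ∷ cs)) e
    ∷ map⁺ (All.map (λ e′ → trans (cong (p c ∧_) e′) (∧-zeroʳ (p c))) (insertions-all-false p m e cs))

  splitTerm-one-blocked : ∀ m b bs (F G : List ℕ → ℕ) → b < m →
    All (λ σ → splitTerm 1 F G (b ∷ σ) ≡ 0) (insertions m bs)
  splitTerm-one-blocked m b bs F G b<m =
    All.map (λ {σ} e → cong (λ x → ind (x ∧ true) * (F (b ∷ []) * G σ)) e)
            (insertions-all-false (_<ᵇ b) m (<ᵇ-false (<⇒≤ b<m)) bs)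

  -- With the maximum m in front, the constraint m puts on the suffix is void.
  splitTerm-maxFirst : ∀ m b p bs (F G : List ℕ → ℕ) → All (_< m) bs →
    splitTerm (2 + p) F G (m ∷ b ∷ bs) ≡
    splitTerm p (λ α → F (m ∷ b ∷ α)) (λ δ → ind (all (_<ᵇ b) δ) * G δ) bs
  splitTerm-maxFirst m b p bs F G bs<m =
    trans (splitTerm-cons (suc p) m F G (b ∷ bs))
          (trans (splitTerm-cons p b (F ∘ (m ∷_)) (λ δ → ind (all (_<ᵇ m) δ) * G δ) bs)
                 (cong (λ y → ind (splitsAt p bs) * (F (m ∷ b ∷ take p bs) * (ind (all (_<ᵇ b) (drop p bs)) * y)))
                       suffixBelowM))
    where
    suffixBelowM : ind (all (_<ᵇ m) (drop p bs)) * G (drop p bs) ≡ G (drop p bs)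
    suffixBelowM = trans (cong (λ x → ind x * G (drop p bs)) (all-true (All.map <ᵇ-true (drop⁺ p bs<m))))
                         (*-identityˡ _)

  singleTerm : ∀ f g → 1 * (f * g) + 0 ≡ 1 * ((f + 0) * g)
  singleTerm = solve-∀

  -- Inserting a maximum m into τ and splitting after position p+1 (so that m
  -- lies in the prefix) amounts to splitting τ after p and inserting m into the prefix.
  ∑-insertions-splitTerm : ∀ m p τ (F G : List ℕ → ℕ) → All (_< m) τ →
    ∑ (insertions m τ) (splitTerm (suc p) F G) ≡ splitTerm p (λ α → ∑ (insertions m α) F) G τ
  ∑-insertions-splitTerm m zero    [] F G _ = singleTerm (F (m ∷ [])) (G [])
  ∑-insertions-splitTerm m (suc p) [] F G _ = singleTerm (F (m ∷ [])) (G [])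
  ∑-insertions-splitTerm m zero (b ∷ bs) F G b∷bs<m = begin
    splitTerm 1 F G (m ∷ b ∷ bs) + ∑ (map (b ∷_) (insertions m bs)) (splitTerm 1 F G)
      ≡⟨ cong₂ _+_ (cong (λ x → ind (x ∧ true) * (F (m ∷ []) * G (b ∷ bs))) (all-true (All.map <ᵇ-true b∷bs<m)))
                   (trans (∑-map (b ∷_) (insertions m bs) (splitTerm 1 F G))
                          (∑-congᴬ (splitTerm-one-blocked m b bs F G (All.head b∷bs<m)))) ⟩
    1 * (F (m ∷ []) * G (b ∷ bs)) + ∑ (insertions m bs) (λ _ → 0)
      ≡⟨ cong (1 * (F (m ∷ []) * G (b ∷ bs)) +_) (∑-zero (insertions m bs)) ⟩
    1 * (F (m ∷ []) * G (b ∷ bs)) + 0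
      ≡⟨ singleTerm (F (m ∷ [])) (G (b ∷ bs)) ⟩
    1 * ((F (m ∷ []) + 0) * G (b ∷ bs))
      ∎
    where open ≡-Reasoning
  ∑-insertions-splitTerm m (suc p) (b ∷ bs) F G (_ ∷ bs<m) = begin
    splitTerm (2 + p) F G (m ∷ b ∷ bs) + ∑ (map (b ∷_) (insertions m bs)) (splitTerm (2 + p) F G)
      ≡⟨ cong₂ _+_ (splitTerm-maxFirst m b p bs F G bs<m) restTerms ⟩
    splitTerm p (λ α → F (m ∷ b ∷ α)) Gb bs + splitTerm p (λ α → ∑ (insertions m α) (F ∘ (b ∷_))) Gb bs
      ≡⟨ splitTerm-+ p (λ α → F (m ∷ b ∷ α)) (λ α → ∑ (insertions m α) (F ∘ (b ∷_))) Gb bs ⟩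
    splitTerm p (λ α → F (m ∷ b ∷ α) + ∑ (insertions m α) (F ∘ (b ∷_))) Gb bs
      ≡⟨ splitTerm-congˡ p Gb bs (λ α → cong (F (m ∷ b ∷ α) +_) (sym (∑-map (b ∷_) (insertions m α) F))) ⟩
    splitTerm p (λ α → ∑ (insertions m (b ∷ α)) F) Gb bs
      ≡⟨ sym (splitTerm-cons p b (λ α → ∑ (insertions m α) F) G bs) ⟩
    splitTerm (suc p) (λ α → ∑ (insertions m α) F) G (b ∷ bs)
      ∎
    where
    open ≡-Reasoning
    Gb : List ℕ → ℕ
    Gb δ = ind (all (_<ᵇ b) δ) * G δ
    restTerms : ∑ (map (b ∷_) (insertions m bs)) (splitTerm (2 + p) F G) ≡
                splitTerm p (λ α → ∑ (insertions m α) (F ∘ (b ∷_))) Gb bs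
    restTerms = trans (∑-map (b ∷_) (insertions m bs) (splitTerm (2 + p) F G))
                      (trans (∑-cong (insertions m bs) (splitTerm-cons (suc p) b F G))
                             (∑-insertions-splitTerm m p bs (F ∘ (b ∷_)) Gb bs<m))

  ∑-insertions-map : ∀ (f : ℕ → ℕ) a τ (F : List ℕ → ℕ) →
    ∑ (insertions (f a) (map f τ)) F ≡ ∑ (insertions a τ) (F ∘ map f)
  ∑-insertions-map f a []       F = refl
  ∑-insertions-map f a (b ∷ bs) F =
    cong (F (f a ∷ f b ∷ map f bs) +_)
      (trans (∑-map (f b ∷_) (insertions (f a) (map f bs)) F)
      (trans (∑-insertions-map f a bs (F ∘ (f b ∷_)))
             (sym (∑-map (b ∷_) (insertions a bs) (F ∘ map f)))))

  -- The permutations of [p+q] splitting after position p are exactly the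
  -- concatenations of a permutation of {q+1,…,q+p} and one of [q]; hence the
  -- split sum factors.
  ∑-S-splitTerm : ∀ p q (F G : List ℕ → ℕ) →
    ∑ (S (p + q)) (splitTerm p F G) ≡ ∑ (S p) (F ∘ map (_+ q)) * ∑ (S q) G
  ∑-S-splitTerm zero q F G =
    trans (∑-cong (S q) (λ τ → +-identityʳ (F [] * G τ)))
          (trans (∑-*ˡ (S q) (F []) G) (cong (_* ∑ (S q) G) (sym (+-identityʳ (F [])))))
  ∑-S-splitTerm (suc p) q F G = begin
    ∑ (S (suc p + q)) (splitTerm (suc p) F G)
      ≡⟨ ∑-concatMap (insertions (suc p + q)) (S (p + q)) (splitTerm (suc p) F G) ⟩
    ∑ (S (p + q)) (λ τ → ∑ (insertions (suc p + q) τ) (splitTerm (suc p) F G))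
      ≡⟨ ∑-congᴬ (All.map (λ wf → ∑-insertions-splitTerm (suc p + q) p _ F G (proj₁ wf)) (S-wellFormed (p + q))) ⟩
    ∑ (S (p + q)) (splitTerm p (λ α → ∑ (insertions (suc p + q) α) F) G)
      ≡⟨ ∑-S-splitTerm p q (λ α → ∑ (insertions (suc p + q) α) F) G ⟩
    ∑ (S p) (λ α → ∑ (insertions (suc p + q) (map (_+ q) α)) F) * ∑ (S q) G
      ≡⟨ cong (_* ∑ (S q) G) (∑-cong (S p) (λ α → ∑-insertions-map (_+ q) (suc p) α F)) ⟩
    ∑ (S p) (λ α → ∑ (insertions (suc p) α) (F ∘ map (_+ q))) * ∑ (S q) G
      ≡⟨ cong (_* ∑ (S q) G) (sym (∑-concatMap (insertions (suc p)) (S p) (F ∘ map (_+ q)))) ⟩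
    ∑ (S (suc p)) (F ∘ map (_+ q)) * ∑ (S q) G
      ∎
    where open ≡-Reasoning

  <ᵇ-shift : ∀ a b q → (a + q <ᵇ b + q) ≡ (a <ᵇ b)
  <ᵇ-shift a b zero    = cong₂ _<ᵇ_ (+-identityʳ a) (+-identityʳ b)
  <ᵇ-shift a b (suc q) = trans (cong₂ _<ᵇ_ (+-suc a q) (+-suc b q)) (<ᵇ-shift a b q)

  has21Above-shift : ∀ a q L → has21Above (a + q) (map (_+ q) L) ≡ has21Above a L
  has21Above-shift a q []       = refl
  has21Above-shift a q (b ∷ cs) = cong₂ _∨_
    (trans (any-map (λ c → (a + q <ᵇ c) ∧ (c <ᵇ b + q)) (_+ q) cs)
           (any-cong {L = cs} (All.tabulate (λ {c} _ → cong₂ _∧_ (<ᵇ-shift a c q) (<ᵇ-shift c b q)))))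
    (has21Above-shift a q cs)

  contains132-shift : ∀ q L → contains132 (map (_+ q) L) ≡ contains132 L
  contains132-shift q []      = refl
  contains132-shift q (a ∷ L) = cong₂ _∨_ (has21Above-shift a q L) (contains132-shift q L)

  avoids132-shift : ∀ q L → avoids132 (map (_+ q) L) ≡ avoids132 L
  avoids132-shift q L = cong (λ b → if b then false else true) (contains132-shift q L)

  W : ℕ → (ℕ → ℕ) → ℕ
  W n H = ∑ (S n) (weight H)

  avoiders : ℕ → ℕ
  avoiders n = ∑ (S n) (ind ∘ avoids132)

  -- Decomposing σ = A (n+1) B with |A| = i:  A is any 132-avoiding arrangement
  -- of the top i values, B any 132-avoider of [n-i], and the maximum adds a
  -- special point exactly when i = 0.
  W-rec : ∀ n H → W (suc n) H ≡ sumUpTo n (λ i → avoiders i * W (n ∸ i) (λ v → H (ind (i ≡ᵇ 0) + v)))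
  W-rec n H = begin
    ∑ (S (suc n)) (weight H)
      ≡⟨ ∑-concatMap (insertions (suc n)) (S n) (weight H) ⟩
    ∑ (S n) (λ τ → ∑ (insertions (suc n) τ) (weight H))
      ≡⟨ ∑-congᴬ (All.map (∑-weight-insertions n _ H) (S-wellFormed n)) ⟩
    ∑ (S n) (λ τ → sumUpTo n (λ i → splitTerm i (ind ∘ avoids132) (H′ i) τ))
      ≡⟨ ∑-sumUpTo (S n) n (λ τ i → splitTerm i (ind ∘ avoids132) (H′ i) τ) ⟩
    sumUpTo n (λ i → ∑ (S n) (splitTerm i (ind ∘ avoids132) (H′ i)))
      ≡⟨ sumUpTo-cong n factor ⟩
    sumUpTo n (λ i → avoiders i * W (n ∸ i) (λ v → H (ind (i ≡ᵇ 0) + v)))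
      ∎
    where
    open ≡-Reasoning
    H′ : ℕ → List ℕ → ℕ
    H′ i = weight (λ v → H (ind (i ≡ᵇ 0) + v))
    factor : ∀ i → i ≤ n → ∑ (S n) (splitTerm i (ind ∘ avoids132) (H′ i)) ≡
                          avoiders i * W (n ∸ i) (λ v → H (ind (i ≡ᵇ 0) + v))
    factor i i≤n =
      trans (cong (λ l → ∑ (S l) (splitTerm i (ind ∘ avoids132) (H′ i))) (sym (m+[n∸m]≡n i≤n)))
            (trans (∑-S-splitTerm i (n ∸ i) (ind ∘ avoids132) (H′ i))
                   (cong (_* W (n ∸ i) (λ v → H (ind (i ≡ᵇ 0) + v)))
                         (∑-cong (S i) (λ α → cong ind (avoids132-shift (n ∸ i) α)))))

module RangeSums where
  open import Data.Nat as ℕ using (zero; suc; _∸_; _≤_; z≤n)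
  import Data.Nat.Properties as ℕP
  open import Data.Integer using (ℤ; +_; -_; _+_; _-_)
  open import Data.Integer.Properties using (+-assoc; +-comm; neg-distrib-+; pos-+)
  open import Data.Integer.Tactic.RingSolver using (solve-∀)
  open Counting using (sumUpTo)

  sumTo-front : ∀ n (f : ℕ → ℤ) → sumTo (suc n) f ≡ f 0 + sumTo n (f ∘ suc)
  sumTo-front zero    f = refl
  sumTo-front (suc n) f = trans (cong (_+ f (suc (suc n))) (sumTo-front n f)) (+-assoc (f 0) _ _)

  sumTo-+ : ∀ n (f g : ℕ → ℤ) → sumTo n (λ i → f i + g i) ≡ sumTo n f + sumTo n g
  sumTo-+ zero    f g = refl
  sumTo-+ (suc n) f g =
    trans (cong (_+ (f (suc n) + g (suc n))) (sumTo-+ n f g))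
          (interchange (sumTo n f) (sumTo n g) (f (suc n)) (g (suc n)))
    where
    interchange : ∀ a b c d → (a + b) + (c + d) ≡ (a + c) + (b + d)
    interchange = solve-∀

  sumTo-cong : ∀ n {f g : ℕ → ℤ} → (∀ i → i ≤ n → f i ≡ g i) → sumTo n f ≡ sumTo n g
  sumTo-cong zero    e = e 0 z≤n
  sumTo-cong (suc n) e = cong₂ _+_ (sumTo-cong n (λ i i≤n → e i (ℕP.m≤n⇒m≤1+n i≤n))) (e (suc n) ℕP.≤-refl)

  sumTo-zero : ∀ n → sumTo n (λ _ → + 0) ≡ + 0
  sumTo-zero zero    = refl
  sumTo-zero (suc n) = cong (_+ + 0) (sumTo-zero n)

  sumTo-neg : ∀ n (f : ℕ → ℤ) → sumTo n (λ i → - f i) ≡ - sumTo n f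
  sumTo-neg zero    f = refl
  sumTo-neg (suc n) f = trans (cong (_+ - f (suc n)) (sumTo-neg n f)) (sym (neg-distrib-+ (sumTo n f) (f (suc n))))

  sumTo-reverse : ∀ n (h : ℕ → ℤ) → sumTo n h ≡ sumTo n (λ i → h (n ∸ i))
  sumTo-reverse zero    h = refl
  sumTo-reverse (suc n) h =
    trans (cong (_+ h (suc n)) (sumTo-reverse n h))
          (trans (+-comm (sumTo n (λ i → h (n ∸ i))) (h (suc n)))
                 (sym (sumTo-front n (λ i → h (suc n ∸ i)))))

  sumTo-embed : ∀ n (f : ℕ → ℕ) → + sumUpTo n f ≡ sumTo n (λ i → + f i)
  sumTo-embed zero    f = refl
  sumTo-embed (suc n) f = trans (pos-+ (sumUpTo n f) (f (suc n))) (cong (_+ + f (suc n)) (sumTo-embed n f))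

  sumTo-replaceFirst : ∀ n (u v : ℕ → ℤ) → (∀ i → u (suc i) ≡ v (suc i)) →
    sumTo n u ≡ sumTo n v + (u 0 - v 0)
  sumTo-replaceFirst zero    u v _ = addDiff (u 0) (v 0)
    where
    addDiff : ∀ a b → a ≡ b + (a - b)
    addDiff = solve-∀
  sumTo-replaceFirst (suc n) u v e =
    trans (cong₂ _+_ (sumTo-replaceFirst n u v e) (e n)) (swap (sumTo n v) (u 0 - v 0) (v (suc n)))
    where
    swap : ∀ s d x → s + d + x ≡ s + x + d
    swap = solve-∀

module Catalan where
  open import Data.Nat as ℕ using (zero; suc; _∸_; _≤_; z≤n; s≤s; _/_)
  import Data.Nat.Properties as ℕP
  open import Data.Nat.Combinatorics using (_C_; nCk+nC[k+1]≡[n+1]C[k+1]; nCk≡nC[n∸k]; k>n⇒nCk≡0; nCn≡1; nC1≡n)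
  open import Data.Nat.DivMod using (m*n/n≡m)
  open import Data.Nat.Tactic.RingSolver using (solve-∀)
  open import Data.Integer using (ℤ; +_; _+_; _*_; _-_)
  open import Data.Integer.Properties
    using (+-identityˡ; +-identityʳ; +-inverseʳ; +-assoc; *-identityˡ; *-distribʳ-+; pos-+; pos-*; m-n≡m⊖n; ⊖-≥)
  open import Data.Integer.Tactic.RingSolver using () renaming (solve-∀ to ℤ-solve-∀)
  open import Data.Sum using (inj₁; inj₂)
  open Counting using (sumUpTo; sumUpTo-cong; W; W-rec; avoiders; ∑-cong)
  open RangeSums

  avoiders-rec : ∀ n → avoiders (suc n) ≡ sumUpTo n (λ i → avoiders i ℕ.* avoiders (n ∸ i))
  avoiders-rec n =
    trans (sym (W-const (suc n)))
          (trans (W-rec n (λ _ → 1))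
                 (sumUpTo-cong n (λ i _ → cong (avoiders i ℕ.*_) (W-const (n ∸ i)))))
    where
    W-const : ∀ m → W m (λ _ → 1) ≡ avoiders m
    W-const m = ∑-cong (S m) (λ σ → ℕP.*-identityʳ _)

  binomDiff : ℕ → ℕ → ℤ
  binomDiff N k = + (N C k) - + (N C suc k)

  binomDiff-pascal : ∀ M K → binomDiff (suc M) (suc K) ≡ binomDiff M K + binomDiff M (suc K)
  binomDiff-pascal M K =
    trans (cong₂ (λ x y → x - y) (pascal K) (pascal (suc K)))
          (telescope (+ (M C K)) (+ (M C suc K)) (+ (M C suc (suc K))))
    where
    telescope : ∀ a b c → (a + b) - (b + c) ≡ (a - b) + (b - c)
    telescope = ℤ-solve-∀
    pascal : ∀ k → + (suc M C suc k) ≡ + (M C k) + + (M C suc k)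
    pascal k = trans (cong +_ (sym (nCk+nC[k+1]≡[n+1]C[k+1] M k))) (pos-+ (M C k) (M C suc k))

  -- ballot m n = [tⁿ] C(t)^m  (the ballot numbers).
  ballot : ℕ → ℕ → ℤ
  ballot zero    zero    = + 1
  ballot zero    (suc n) = + 0
  ballot (suc m) n       = binomDiff (n ℕ.+ n ℕ.+ m) (n ℕ.+ m)

  ballot-zero : ∀ m → ballot m 0 ≡ + 1
  ballot-zero zero    = refl
  ballot-zero (suc m) = cong₂ (λ x y → + x - + y) (nCn≡1 m) (k>n⇒nCk≡0 (ℕP.n<1+n m))

  -- C(t)^{j+1} = C(t)^j + t·C(t)^{j+2}, a consequence of C = 1 + t·C².
  ballot-step : ∀ j i → ballot (suc j) (suc i) ≡ ballot j (suc i) + ballot (suc (suc j)) i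
  ballot-step zero i = begin
    binomDiff (suc i ℕ.+ suc i ℕ.+ 0) (suc i ℕ.+ 0)   ≡⟨ cong₂ binomDiff top (ℕP.+-identityʳ (suc i)) ⟩
    binomDiff (suc N) (suc i)                         ≡⟨ binomDiff-pascal N i ⟩
    binomDiff N i + binomDiff N (suc i)               ≡⟨ cong (_+ binomDiff N (suc i)) middleVanishes ⟩
    + 0 + binomDiff N (suc i)                         ≡⟨ +-identityˡ _ ⟩
    binomDiff N (suc i)                               ≡⟨ cong (binomDiff N) (ℕP.+-comm 1 i) ⟩
    binomDiff N (i ℕ.+ 1)                             ≡⟨ sym (+-identityˡ _) ⟩
    + 0 + binomDiff N (i ℕ.+ 1)                       ∎
    where
    open ≡-Reasoning
    N : ℕ
    N = i ℕ.+ i ℕ.+ 1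
    top : suc i ℕ.+ suc i ℕ.+ 0 ≡ suc N
    top = cong suc (trans (ℕP.+-identityʳ (i ℕ.+ suc i)) (trans (ℕP.+-suc i i) (ℕP.+-comm 1 (i ℕ.+ i))))
    -- the central binomial coefficients of the odd row 2i+1 coincide
    middleVanishes : binomDiff N i ≡ + 0
    middleVanishes = trans (cong (λ z → + z - + (N C suc i)) symmetric) (+-inverseʳ (+ (N C suc i)))
      where
      N∸i : N ∸ i ≡ suc i
      N∸i = trans (cong (_∸ i) (trans (ℕP.+-assoc i i 1) (ℕP.+-comm i (i ℕ.+ 1))))
                  (trans (ℕP.m+n∸n≡m (i ℕ.+ 1) i) (ℕP.+-comm i 1))
      symmetric : N C i ≡ N C suc i
      symmetric = trans (nCk≡nC[n∸k] (ℕP.≤-trans (ℕP.m≤m+n i i) (ℕP.m≤m+n (i ℕ.+ i) 1))) (cong (N C_) N∸i)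
  ballot-step (suc j) i =
    trans (cong (λ N → binomDiff N (suc i ℕ.+ suc j)) rowL)
          (trans (binomDiff-pascal (i ℕ.+ i ℕ.+ suc (suc j)) (i ℕ.+ suc j))
                 (cong₂ _+_ (sym (cong₂ binomDiff rowR (sym (ℕP.+-suc i j))))
                            (sym (cong (binomDiff (i ℕ.+ i ℕ.+ suc (suc j))) (ℕP.+-suc i (suc j))))))
    where
    rowL : suc i ℕ.+ suc i ℕ.+ suc j ≡ suc (i ℕ.+ i ℕ.+ suc (suc j))
    rowL = cong suc (trans (cong (ℕ._+ suc j) (ℕP.+-suc i i)) (sym (ℕP.+-suc (i ℕ.+ i) (suc j))))
    rowR : suc i ℕ.+ suc i ℕ.+ j ≡ i ℕ.+ i ℕ.+ suc (suc j)
    rowR = trans (cong suc (cong (ℕ._+ j) (ℕP.+-suc i i)))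
                 (trans (cong suc (sym (ℕP.+-suc (i ℕ.+ i) j))) (sym (ℕP.+-suc (i ℕ.+ i) (suc j))))

  ballot-conv : ∀ j m n → sumTo n (λ i → ballot j i * ballot m (n ∸ i)) ≡ ballot (j ℕ.+ m) n
  ballot-conv j m zero =
    trans (cong₂ _*_ (ballot-zero j) (ballot-zero m)) (sym (ballot-zero (j ℕ.+ m)))
  ballot-conv zero m (suc n) =
    trans (sumTo-front n (λ i → ballot zero i * ballot m (suc n ∸ i)))
          (trans (cong (λ s → ballot zero 0 * ballot m (suc n) + s) (sumTo-zero n))
                 (trans (+-identityʳ _) (*-identityˡ _)))
  ballot-conv (suc j) m (suc n) = begin
    sumTo (suc n) (λ i → ballot (suc j) i * ballot m (suc n ∸ i))
      ≡⟨ sumTo-front n _ ⟩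
    ballot (suc j) 0 * ballot m (suc n) + sumTo n (λ i → ballot (suc j) (suc i) * ballot m (n ∸ i))
      ≡⟨ cong₂ _+_ (cong (_* ballot m (suc n)) (trans (ballot-zero (suc j)) (sym (ballot-zero j))))
                   (trans (sumTo-cong n (λ i _ → cong (_* ballot m (n ∸ i)) (ballot-step j i)))
                   (trans (sumTo-cong n (λ i _ → *-distribʳ-+ (ballot m (n ∸ i)) (ballot j (suc i)) _))
                          (sumTo-+ n _ _))) ⟩
    ballot j 0 * ballot m (suc n) + (sumTo n (λ i → ballot j (suc i) * ballot m (n ∸ i))
                                     + sumTo n (λ i → ballot (suc (suc j)) i * ballot m (n ∸ i)))
      ≡⟨ sym (+-assoc (ballot j 0 * ballot m (suc n)) _ _) ⟩
    ballot j 0 * ballot m (suc n) + sumTo n (λ i → ballot j (suc i) * ballot m (n ∸ i))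
      + sumTo n (λ i → ballot (suc (suc j)) i * ballot m (n ∸ i))
      ≡⟨ cong (_+ sumTo n (λ i → ballot (suc (suc j)) i * ballot m (n ∸ i)))
              (sym (sumTo-front n (λ i → ballot j i * ballot m (suc n ∸ i)))) ⟩
    sumTo (suc n) (λ i → ballot j i * ballot m (suc n ∸ i))
      + sumTo n (λ i → ballot (suc (suc j)) i * ballot m (n ∸ i))
      ≡⟨ cong₂ _+_ (ballot-conv j m (suc n)) (ballot-conv (suc (suc j)) m n) ⟩
    ballot (j ℕ.+ m) (suc n) + ballot (suc (suc j ℕ.+ m)) n
      ≡⟨ sym (ballot-step (j ℕ.+ m) n) ⟩
    ballot (suc j ℕ.+ m) (suc n)
      ∎
    where open ≡-Reasoning

  absorption : ∀ N k → suc k ℕ.* (suc N C suc k) ≡ suc N ℕ.* (N C k)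
  absorption zero    zero    = refl
  absorption zero    (suc k) =
    trans (cong (suc (suc k) ℕ.*_) (k>n⇒nCk≡0 {1} {suc (suc k)} (s≤s (s≤s z≤n))))
          (trans (ℕP.*-zeroʳ (suc (suc k))) (sym (cong (1 ℕ.*_) (k>n⇒nCk≡0 {0} {suc k} (s≤s z≤n)))))
  absorption (suc N) zero    =
    trans (ℕP.*-identityˡ _) (trans (nC1≡n (suc (suc N))) (sym (ℕP.*-identityʳ _)))
  absorption (suc N) (suc k) = begin
    suc (suc k) ℕ.* (suc (suc N) C suc (suc k)) ≡⟨ cong (suc (suc k) ℕ.*_) (sym (nCk+nC[k+1]≡[n+1]C[k+1] (suc N) (suc k))) ⟩
    suc (suc k) ℕ.* (a ℕ.+ b)                   ≡⟨ split k a b ⟩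
    (suc k ℕ.* a ℕ.+ a) ℕ.+ suc (suc k) ℕ.* b   ≡⟨ cong₂ (λ u v → (u ℕ.+ a) ℕ.+ v) (absorption N k) (absorption N (suc k)) ⟩
    (suc N ℕ.* x ℕ.+ a) ℕ.+ suc N ℕ.* y         ≡⟨ regroup N x a y ⟩
    suc N ℕ.* (x ℕ.+ y) ℕ.+ a                   ≡⟨ cong (λ z → suc N ℕ.* z ℕ.+ a) (nCk+nC[k+1]≡[n+1]C[k+1] N k) ⟩
    suc N ℕ.* a ℕ.+ a                           ≡⟨ merge N a ⟩
    suc (suc N) ℕ.* a                           ∎
    where
    open ≡-Reasoning
    a b x y : ℕ
    a = suc N C suc k
    b = suc N C suc (suc k)
    x = N C k
    y = N C suc k
    split : ∀ k a b → (2 ℕ.+ k) ℕ.* (a ℕ.+ b) ≡ ((1 ℕ.+ k) ℕ.* a ℕ.+ a) ℕ.+ (2 ℕ.+ k) ℕ.* b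
    split = solve-∀
    regroup : ∀ N x a y → ((1 ℕ.+ N) ℕ.* x ℕ.+ a) ℕ.+ (1 ℕ.+ N) ℕ.* y ≡ (1 ℕ.+ N) ℕ.* (x ℕ.+ y) ℕ.+ a
    regroup = solve-∀
    merge : ∀ N a → (1 ℕ.+ N) ℕ.* a ℕ.+ a ≡ (2 ℕ.+ N) ℕ.* a
    merge = solve-∀

  catalan-binomDiff : ∀ n → + catalan n ≡ binomDiff (2 ℕ.* n) n
  catalan-binomDiff n = trans (cong +_ catalan≡c∸d) (sym (trans (m-n≡m⊖n c d) (⊖-≥ d≤c)))
    where
    c d : ℕ
    c = (2 ℕ.* n) C n
    d = (2 ℕ.* n) C suc n
    ratio : suc n ℕ.* d ≡ n ℕ.* c
    ratio = ℕP.+-cancelˡ-≡ (suc n ℕ.* c) _ _ (begin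
      suc n ℕ.* c ℕ.+ suc n ℕ.* d       ≡⟨ sym (ℕP.*-distribˡ-+ (suc n) c d) ⟩
      suc n ℕ.* (c ℕ.+ d)               ≡⟨ cong (suc n ℕ.*_) (nCk+nC[k+1]≡[n+1]C[k+1] (2 ℕ.* n) n) ⟩
      suc n ℕ.* (suc (2 ℕ.* n) C suc n) ≡⟨ absorption (2 ℕ.* n) n ⟩
      suc (2 ℕ.* n) ℕ.* c               ≡⟨ double n c ⟩
      suc n ℕ.* c ℕ.+ n ℕ.* c           ∎)
      where
      open ≡-Reasoning
      double : ∀ n c → (1 ℕ.+ 2 ℕ.* n) ℕ.* c ≡ (1 ℕ.+ n) ℕ.* c ℕ.+ n ℕ.* c
      double = solve-∀
    d≤c : d ≤ c
    d≤c = ℕP.*-cancelˡ-≤ (suc n) (subst (ℕ._≤ suc n ℕ.* c) (sym ratio) (ℕP.*-monoˡ-≤ c (ℕP.n≤1+n n)))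
    c≡[c∸d][n+1] : c ≡ (c ∸ d) ℕ.* suc n
    c≡[c∸d][n+1] = sym (begin
      (c ∸ d) ℕ.* suc n           ≡⟨ ℕP.*-comm (c ∸ d) (suc n) ⟩
      suc n ℕ.* (c ∸ d)           ≡⟨ ℕP.*-distribˡ-∸ (suc n) c d ⟩
      suc n ℕ.* c ∸ suc n ℕ.* d   ≡⟨ cong (suc n ℕ.* c ∸_) ratio ⟩
      c ℕ.+ n ℕ.* c ∸ n ℕ.* c     ≡⟨ ℕP.m+n∸n≡m c (n ℕ.* c) ⟩
      c                           ∎)
      where open ≡-Reasoning
    catalan≡c∸d : catalan n ≡ c ∸ d
    catalan≡c∸d = trans (cong (_/ suc n) c≡[c∸d][n+1]) (m*n/n≡m (c ∸ d) (suc n))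

  catalan-ballot : ∀ n → + catalan n ≡ ballot 1 n
  catalan-ballot n =
    trans (catalan-binomDiff n) (cong₂ binomDiff (twice n) (sym (ℕP.+-identityʳ n)))
    where
    twice : ∀ n → 2 ℕ.* n ≡ n ℕ.+ n ℕ.+ 0
    twice = solve-∀

  -- a(n) = [tⁿ] C(t), by strong induction through the shared Catalan recurrence.
  avoiders-ballot : ∀ n i → i ≤ n → + avoiders i ≡ ballot 1 i
  avoiders-ballot zero    zero    _   = refl
  avoiders-ballot (suc n) i       i≤1+n with ℕP.m≤n⇒m<n∨m≡n i≤1+n
  ... | inj₁ (s≤s i≤n) = avoiders-ballot n i i≤n
  ... | inj₂ refl      = begin
    + avoiders (suc n)                                          ≡⟨ cong +_ (avoiders-rec n) ⟩
    + sumUpTo n (λ i → avoiders i ℕ.* avoiders (n ∸ i))          ≡⟨ sumTo-embed n _ ⟩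
    sumTo n (λ i → + (avoiders i ℕ.* avoiders (n ∸ i)))         ≡⟨ sumTo-cong n byHypothesis ⟩
    sumTo n (λ i → ballot 1 i * ballot 1 (n ∸ i))               ≡⟨ ballot-conv 1 1 n ⟩
    ballot 2 n                                                  ≡⟨ sym (+-identityˡ _) ⟩
    ballot 0 (suc n) + ballot 2 n                               ≡⟨ sym (ballot-step 0 n) ⟩
    ballot 1 (suc n)                                            ∎
    where
    open ≡-Reasoning
    byHypothesis : ∀ j → j ≤ n → + (avoiders j ℕ.* avoiders (n ∸ j)) ≡ ballot 1 j * ballot 1 (n ∸ j)
    byHypothesis j j≤n = trans (pos-* (avoiders j) (avoiders (n ∸ j)))
                               (cong₂ _*_ (avoiders-ballot n j j≤n) (avoiders-ballot n (n ∸ j) (ℕP.m∸n≤m n j)))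

  catalan≡avoiders : ∀ n → + catalan n ≡ + avoiders n
  catalan≡avoiders n = trans (catalan-ballot n) (sym (avoiders-ballot n n ℕP.≤-refl))

module PowerSeries where
  open import Data.Nat as ℕ using (zero; suc; _∸_; _≤_; _<_; _≤ᵇ_; _≡ᵇ_)
  open import Data.Nat.Properties as ℕP using (≤⇒≤ᵇ; ≡⇒≡ᵇ; ≡ᵇ⇒≡; <-cmp)
  open import Data.Integer using (ℤ; +_; -_; _+_; _*_; _-_)
  open import Data.Integer.Properties using (+-identityʳ; +-identityˡ; *-identityˡ; *-comm; *-zeroʳ; neg-distribˡ-*; pos-*)
  open import Data.Integer.Tactic.RingSolver using (solve-∀)
  open import Relation.Binary.Definitions using (tri<; tri≈; tri>)
  open Counting using (ind; ∑; ∑-cong; ∑-zero; sumUpTo; <ᵇ-false; W; W-rec; avoiders)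
  open Catalan using (catalan≡avoiders)
  open RangeSums

  -- The Cauchy product is commutative (reverse both index ranges).
  ⊛-comm : ∀ F G n k → (F ⊛ G) n k ≡ (G ⊛ F) n k
  ⊛-comm F G n k =
    trans (sumTo-reverse n _)
          (sumTo-cong n λ i i≤n →
            trans (sumTo-reverse k _)
                  (sumTo-cong k λ j j≤k →
                    trans (*-comm (F (n ∸ i) (k ∸ j)) (G (n ∸ (n ∸ i)) (k ∸ (k ∸ j))))
                          (cong₂ (λ a b → G a b * F (n ∸ i) (k ∸ j)) (ℕP.m∸[m∸n]≡n i≤n) (ℕP.m∸[m∸n]≡n j≤k))))

  ≤ᵇ-true : ∀ {m n} → m ≤ n → (m ≤ᵇ n) ≡ true
  ≤ᵇ-true m≤n = Equivalence.to T-≡ (≤⇒≤ᵇ m≤n)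

  ≤ᵇ-false : ∀ {m n} → n < m → (m ≤ᵇ n) ≡ false
  ≤ᵇ-false {suc m} n<1+m = <ᵇ-false (ℕP.≤-pred n<1+m)

  ≡ᵇ-refl : ∀ n → (n ≡ᵇ n) ≡ true
  ≡ᵇ-refl n = Equivalence.to T-≡ (≡⇒≡ᵇ n n refl)

  ≡ᵇ-false : ∀ {m n} → m ≢ n → (m ≡ᵇ n) ≡ false
  ≡ᵇ-false {m} {n} m≢n with m ≡ᵇ n in e
  ... | false = refl
  ... | true  = contradiction (≡ᵇ⇒≡ m n (Equivalence.from T-≡ e)) m≢n

  sumTo-indicator : ∀ n c (f : ℕ → ℤ) →
    sumTo n (λ i → if i ≡ᵇ c then f i else + 0) ≡ (if c ≤ᵇ n then f c else + 0)
  sumTo-indicator zero    zero    f = refl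
  sumTo-indicator zero    (suc c) f = refl
  sumTo-indicator (suc n) c f with <-cmp c (suc n)
  ... | tri< c<1+n _ _
    rewrite sumTo-indicator n c f | ≤ᵇ-true (ℕP.≤-pred c<1+n) | ≤ᵇ-true (ℕP.<⇒≤ c<1+n)
          | ≡ᵇ-false {suc n} {c} (λ e → ℕP.<-irrefl (sym e) c<1+n) = +-identityʳ (f c)
  ... | tri≈ _ refl _
    rewrite sumTo-indicator n (suc n) f | ≤ᵇ-false {suc n} {n} ℕP.≤-refl | ≡ᵇ-refl n
          | ≤ᵇ-true (ℕP.≤-refl {suc n}) = +-identityˡ (f (suc n))
  ... | tri> _ _ c>1+n
    rewrite sumTo-indicator n c f | ≤ᵇ-false c>1+n | ≤ᵇ-false {c} {n} (ℕP.<-trans ℕP.≤-refl c>1+n)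
          | ≡ᵇ-false {suc n} {c} (λ e → ℕP.<-irrefl e c>1+n) = refl

  mono-⊛ : ∀ a b F i j → (mono a b ⊛ F) i j ≡
    (if a ≤ᵇ i then (if b ≤ᵇ j then F (i ∸ a) (j ∸ b) else + 0) else + 0)
  mono-⊛ a b F i j =
    trans (sumTo-cong i (λ a′ _ → trans (sumTo-cong j (λ b′ _ → term a′ b′)) (row a′)))
          (sumTo-indicator i a (λ a′ → if b ≤ᵇ j then F (i ∸ a′) (j ∸ b) else + 0))
    where
    term : ∀ a′ b′ → mono a b a′ b′ * F (i ∸ a′) (j ∸ b′) ≡
           (if a′ ≡ᵇ a then (if b′ ≡ᵇ b then F (i ∸ a′) (j ∸ b′) else + 0) else + 0)
    term a′ b′ with a′ ≡ᵇ a | b′ ≡ᵇ b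
    ... | true  | true  = *-identityˡ _
    ... | true  | false = refl
    ... | false | _     = refl
    row : ∀ a′ → sumTo j (λ b′ → if a′ ≡ᵇ a then (if b′ ≡ᵇ b then F (i ∸ a′) (j ∸ b′) else + 0) else + 0) ≡
                 (if a′ ≡ᵇ a then (if b ≤ᵇ j then F (i ∸ a′) (j ∸ b) else + 0) else + 0)
    row a′ with a′ ≡ᵇ a
    ... | true  = sumTo-indicator j b (λ b′ → F (i ∸ a′) (j ∸ b′))
    ... | false = sumTo-zero j

  𝟙-noX : ∀ n k → 𝟙 n (suc k) ≡ + 0
  𝟙-noX n k = cong (λ b → if b then + 1 else + 0) (∧-zeroʳ (n ≡ᵇ 0))

  shiftT : FPS → FPS
  shiftT F zero    j = + 0
  shiftT F (suc i) j = F i j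

  t-⊛ : ∀ F i j → (tS ⊛ F) i j ≡ shiftT F i j
  t-⊛ F zero    j = mono-⊛ 1 0 F zero j
  t-⊛ F (suc i) j = mono-⊛ 1 0 F (suc i) j

  D D₀ : FPS
  D  = 𝟙 ⊖ tS ⊛ xS ⊕ tS ⊖ tS ⊛ CS
  D₀ = 𝟙 ⊕ tS ⊖ tS ⊛ CS

  -- Their coefficients:  [tⁱ] (1 + t - tC(t)) = d₀ i  and  [tⁱ] (-t) = d₁ i.
  δ₀ : ℕ → ℤ
  δ₀ zero    = + 1
  δ₀ (suc _) = + 0

  d₀ d₁ : ℕ → ℤ
  d₀ zero    = + 1
  d₀ (suc i) = δ₀ i - + catalan i
  d₁ zero    = + 0
  d₁ (suc i) = - δ₀ i

  denom denom₀ : ℕ → ℕ → ℤ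
  denom i zero          = d₀ i
  denom i (suc zero)    = d₁ i
  denom i (suc (suc j)) = + 0
  denom₀ i zero    = d₀ i
  denom₀ i (suc j) = + 0

  D-coeff : ∀ i j → D i j ≡ denom i j
  D-coeff i j = trans (cong₂ (λ u v → ((𝟙 i j - u) + tS i j) - v) (t-⊛ xS i j) (t-⊛ CS i j)) (table i j)
    where
    table : ∀ i j → ((𝟙 i j - shiftT xS i j) + tS i j) - shiftT CS i j ≡ denom i j
    table zero          zero          = refl
    table zero          (suc zero)    = refl
    table zero          (suc (suc j)) = refl
    table (suc zero)    zero          = refl
    table (suc (suc i)) zero          = refl
    table (suc zero)    (suc zero)    = refl
    table (suc (suc i)) (suc zero)    = refl
    table (suc zero)    (suc (suc j)) = refl
    table (suc (suc i)) (suc (suc j)) = refl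

  D₀-coeff : ∀ i j → D₀ i j ≡ denom₀ i j
  D₀-coeff i j = trans (cong (λ v → (𝟙 i j + tS i j) - v) (t-⊛ CS i j)) (table i j)
    where
    table : ∀ i j → (𝟙 i j + tS i j) - shiftT CS i j ≡ denom₀ i j
    table zero          zero    = refl
    table zero          (suc j) = refl
    table (suc zero)    zero    = refl
    table (suc (suc i)) zero    = refl
    table (suc zero)    (suc j) = refl
    table (suc (suc i)) (suc j) = refl

  catConv : ℕ → (ℕ → ℤ) → ℤ
  catConv n Y = sumTo n (λ i → + catalan i * Y (n ∸ i))

  δ₀-conv : ∀ n (Y : ℕ → ℤ) → sumTo n (λ i → δ₀ i * Y (n ∸ i)) ≡ Y n
  δ₀-conv zero    Y = *-identityˡ (Y 0)
  δ₀-conv (suc n) Y =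
    trans (sumTo-front n (λ i → δ₀ i * Y (suc n ∸ i)))
          (trans (cong (λ s → + 1 * Y (suc n) + s) (sumTo-zero n))
                 (trans (+-identityʳ _) (*-identityˡ _)))

  d₀-conv : ∀ n (Y : ℕ → ℤ) → sumTo (suc n) (λ i → d₀ i * Y (suc n ∸ i)) ≡ Y (suc n) + (Y n - catConv n Y)
  d₀-conv n Y =
    trans (sumTo-front n (λ i → d₀ i * Y (suc n ∸ i)))
          (cong₂ _+_ (*-identityˡ (Y (suc n)))
                 (trans (sumTo-cong n (λ i _ → distrib (δ₀ i) (+ catalan i) (Y (n ∸ i))))
                 (trans (sumTo-+ n (λ i → δ₀ i * Y (n ∸ i)) (λ i → - (+ catalan i * Y (n ∸ i))))
                        (cong₂ _+_ (δ₀-conv n Y) (sumTo-neg n (λ i → + catalan i * Y (n ∸ i)))))))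
    where
    distrib : ∀ a b y → (a - b) * y ≡ a * y + - (b * y)
    distrib = solve-∀

  d₁-conv : ∀ n (Y : ℕ → ℤ) → sumTo (suc n) (λ i → d₁ i * Y (suc n ∸ i)) ≡ - Y n
  d₁-conv n Y =
    trans (sumTo-front n (λ i → d₁ i * Y (suc n ∸ i)))
          (trans (+-identityˡ _)
          (trans (sumTo-cong n (λ i _ → sym (neg-distribˡ-* (δ₀ i) (Y (n ∸ i)))))
          (trans (sumTo-neg n (λ i → δ₀ i * Y (n ∸ i))) (cong -_ (δ₀-conv n Y)))))

  -- Only the columns x⁰ and x¹ of D are nonzero.
  denom-row : ∀ i k (Y : ℕ → ℤ) → sumTo (suc k) (λ j → denom i j * Y (suc k ∸ j)) ≡ d₀ i * Y (suc k) + d₁ i * Y k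
  denom-row i k Y = trans (sumTo-front k (λ j → denom i j * Y (suc k ∸ j))) (cong (λ s → d₀ i * Y (suc k) + s) (tail k))
    where
    tail : ∀ k → sumTo k (λ j → denom i (suc j) * Y (k ∸ j)) ≡ d₁ i * Y k
    tail zero    = refl
    tail (suc k) = trans (sumTo-front k (λ j → denom i (suc j) * Y (suc k ∸ j)))
                         (trans (cong (λ s → d₁ i * Y (suc k) + s) (sumTo-zero k)) (+-identityʳ _))

  length-filter² : ∀ (p q : List ℕ → Bool) L →
    length (filter (λ σ → T? (p σ)) (filter (λ σ → T? (q σ)) L)) ≡ ∑ L (λ σ → ind (q σ) ℕ.* ind (p σ))
  length-filter² p q []      = refl
  length-filter² p q (σ ∷ L) with q σ
  ... | false = length-filter² p q L
  ... | true with p σ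
  ...   | true  = cong suc (length-filter² p q L)
  ...   | false = length-filter² p q L

  count : ℕ → ℕ → ℕ
  count n k = W n (λ v → ind (v ≡ᵇ k))

  Q≡count : ∀ n k → Q n k ≡ + count n k
  Q≡count zero    zero    = refl
  Q≡count zero    (suc k) = refl
  Q≡count (suc n) k       = cong +_ (length-filter² (λ σ → mmp σ ≡ᵇ k) avoids132 (S (suc n)))

  xQ : ℕ → ℕ → ℤ
  xQ n zero    = + 0
  xQ n (suc k) = Q n k

  -- The coefficient form of  Q = 1 + t·Q·(C(t) - 1 + x):  a permutation
  -- A (n+1) B  with |A| = i ≥ 1 contributes C_i·Q_{n-i}, and with A empty x·Q_n.
  Q-rec : ∀ n k → Q (suc n) k ≡ catConv n (λ m → Q m k) + (xQ n k - Q n k)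
  Q-rec n k = begin
    Q (suc n) k
      ≡⟨ Q≡count (suc n) k ⟩
    + count (suc n) k
      ≡⟨ cong +_ (W-rec n (λ v → ind (v ≡ᵇ k))) ⟩
    + sumUpTo n (λ i → avoiders i ℕ.* W (n ∸ i) (λ v → ind (ind (i ≡ᵇ 0) ℕ.+ v ≡ᵇ k)))
      ≡⟨ sumTo-embed n _ ⟩
    sumTo n (λ i → + (avoiders i ℕ.* W (n ∸ i) (λ v → ind (ind (i ≡ᵇ 0) ℕ.+ v ≡ᵇ k))))
      ≡⟨ sumTo-replaceFirst n _ (λ i → + catalan i * Q (n ∸ i) k) laterTerms ⟩
    catConv n (λ m → Q m k) + (+ (1 ℕ.* W n (λ v → ind (suc v ≡ᵇ k))) - + 1 * Q n k)
      ≡⟨ cong₂ (λ a b → catConv n (λ m → Q m k) + (a - b)) (firstTerm k) (*-identityˡ (Q n k)) ⟩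
    catConv n (λ m → Q m k) + (xQ n k - Q n k)
      ∎
    where
    open ≡-Reasoning
    -- i ≥ 1: the avoiders of size i are counted by C_i
    laterTerms : ∀ i → + (avoiders (suc i) ℕ.* count (n ∸ suc i) k) ≡ + catalan (suc i) * Q (n ∸ suc i) k
    laterTerms i = trans (pos-* (avoiders (suc i)) (count (n ∸ suc i) k))
                         (cong₂ _*_ (sym (catalan≡avoiders (suc i))) (sym (Q≡count (n ∸ suc i) k)))
    -- i = 0: the maximum in front is one extra special point
    firstTerm : ∀ k → + (1 ℕ.* W n (λ v → ind (suc v ≡ᵇ k))) ≡ xQ n k
    firstTerm k = trans (cong +_ (ℕP.*-identityˡ _)) (extraPoint k)
      where
      extraPoint : ∀ k → + W n (λ v → ind (suc v ≡ᵇ k)) ≡ xQ n k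
      extraPoint zero    = cong +_ (trans (∑-cong (S n) (λ σ → ℕP.*-zeroʳ (ind (avoids132 σ)))) (∑-zero (S n)))
      extraPoint (suc k) = sym (Q≡count n k)

  constantTerm : ∀ n → sumTo n (λ i → d₀ i * Q (n ∸ i) 0) ≡ 𝟙 n 0
  constantTerm zero    = refl
  constantTerm (suc n) = begin
    sumTo (suc n) (λ i → d₀ i * Q (suc n ∸ i) 0)                 ≡⟨ d₀-conv n Y ⟩
    Q (suc n) 0 + (Q n 0 - catConv n Y)                           ≡⟨ cong (λ q → q + (Q n 0 - catConv n Y)) (Q-rec n 0) ⟩
    catConv n Y + (+ 0 - Q n 0) + (Q n 0 - catConv n Y)           ≡⟨ cancel (catConv n Y) (Q n 0) ⟩
    + 0                                                           ∎
    where
    open ≡-Reasoning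
    Y : ℕ → ℤ
    Y m = Q m 0
    cancel : ∀ s a → s + (+ 0 - a) + (a - s) ≡ + 0
    cancel = solve-∀

  Q⊛D : ∀ n k → (Q ⊛ D) n k ≡ 𝟙 n k
  Q⊛D n k = trans (⊛-comm Q D n k)
                  (trans (sumTo-cong n (λ i _ → sumTo-cong k (λ j _ → cong (_* Q (n ∸ i) (k ∸ j)) (D-coeff i j))))
                         (rows n k))
    where
    rows : ∀ n k → sumTo n (λ i → sumTo k (λ j → denom i j * Q (n ∸ i) (k ∸ j))) ≡ 𝟙 n k
    rows n       zero    = constantTerm n
    rows zero    (suc k) = denom-row 0 k (Q 0)
    rows (suc n) (suc k) = begin
      sumTo (suc n) (λ i → sumTo (suc k) (λ j → denom i j * Q (suc n ∸ i) (suc k ∸ j)))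
        ≡⟨ sumTo-cong (suc n) (λ i _ → denom-row i k (Q (suc n ∸ i))) ⟩
      sumTo (suc n) (λ i → d₀ i * Q (suc n ∸ i) (suc k) + d₁ i * Q (suc n ∸ i) k)
        ≡⟨ sumTo-+ (suc n) (λ i → d₀ i * Y₁ (suc n ∸ i)) (λ i → d₁ i * Y₀ (suc n ∸ i)) ⟩
      sumTo (suc n) (λ i → d₀ i * Y₁ (suc n ∸ i)) + sumTo (suc n) (λ i → d₁ i * Y₀ (suc n ∸ i))
        ≡⟨ cong₂ _+_ (d₀-conv n Y₁) (d₁-conv n Y₀) ⟩
      Q (suc n) (suc k) + (Q n (suc k) - catConv n Y₁) + - Q n k
        ≡⟨ cong (λ q → q + (Q n (suc k) - catConv n Y₁) + - Q n k) (Q-rec n (suc k)) ⟩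
      catConv n Y₁ + (Q n k - Q n (suc k)) + (Q n (suc k) - catConv n Y₁) + - Q n k
        ≡⟨ cancel (catConv n Y₁) (Q n (suc k)) (Q n k) ⟩
      + 0
        ∎
      where
      open ≡-Reasoning
      Y₀ Y₁ : ℕ → ℤ
      Y₀ m = Q m k
      Y₁ m = Q m (suc k)
      cancel : ∀ s a b → s + (b - a) + (a - s) + - b ≡ + 0
      cancel = solve-∀

  Q0⊛D₀ : ∀ n k → (Q0 ⊛ D₀) n k ≡ 𝟙 n k
  Q0⊛D₀ n k = trans (⊛-comm Q0 D₀ n k)
                    (trans (sumTo-cong n (λ i _ → sumTo-cong k (λ j _ → cong (_* Q0 (n ∸ i) (k ∸ j)) (D₀-coeff i j))))
                           (rows k))
    where
    rows : ∀ k → sumTo n (λ i → sumTo k (λ j → denom₀ i j * Q0 (n ∸ i) (k ∸ j))) ≡ 𝟙 n k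
    rows zero    = constantTerm n
    rows (suc k) = trans (sumTo-cong n (λ i _ → noX i)) (trans (sumTo-zero n) (sym (𝟙-noX n k)))
      where
      -- Q(t,0) has no x-terms and D₀ has none either
      noX : ∀ i → sumTo (suc k) (λ j → denom₀ i j * Q0 (n ∸ i) (suc k ∸ j)) ≡ + 0
      noX i = trans (sumTo-front k (λ j → denom₀ i j * Q0 (n ∸ i) (suc k ∸ j)))
                    (cong₂ _+_ (*-zeroʳ (d₀ i)) (sumTo-zero k))

theorem20 : ((n k : ℕ) → (Q ⊛ (𝟙 ⊖ tS ⊛ xS ⊕ tS ⊖ tS ⊛ CS)) n k ≡ 𝟙 n k)
          × ((n k : ℕ) → (Q0 ⊛ (𝟙 ⊕ tS ⊖ tS ⊛ CS)) n k ≡ 𝟙 n k)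
theorem20 = PowerSeries.Q⊛D , PowerSeries.Q0⊛D₀
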